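{- Let $q$ be a prime power and let $\mathcal{F}$ be a star flock of $PG(3,q)$ whose critical cone has non-empty carrier. Then $\mathcal{F}$ is equivalent to a flock of the form $\mathcal{F}(t,g(t),0)$, i.e. to the flock consisting of the planes $tx_0+g(t)x_1-x_3=0$, $t\in GF(q)$, for some function $g\colon GF(q)\to GF(q)$ with $g(0)=0$.
   Context: In $PG(3,q)$ with homogeneous coordinates $(x_0,x_1,x_2,x_3)$, let $V=(0,0,0,1)$ and $\pi_0$ the plane $x_3=0$. For $f,g,h\colon GF(q)\to GF(q)$ with $f(0)=g(0)=h(0)=0$, $\mathcal{F}(f,g,h)$ denotes the set of planes $\pi_t\colon f(t)x_0+g(t)x_1+h(t)x_2-x_3=0$, $t\in GF(q)$; it is a flock when these $q$ planes are distinct. A star flock is a flock whose planes share a common point. For a set $\mathcal{S}$ of points of $\pi_0$, the cone $\Sigma(V,\mathcal{S})$ is the union of the lines $VP$, $P\in\mathcal{S}$; the flock is a flock of this cone if no two distinct planes of the flock meet in a point of the cone. The critical cone is $\Sigma(V,\mathcal{S}_0)$ with $\mathcal{S}_0$ (its carrier) the largest subset of $\pi_0$ with this property. Two flocks are equivalent if there is a collineation of $PG(3,q)$ fixing $V$ and stabilizing the plane $x_3=0$ which maps the planes of one onto the planes of the other. -}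

module Defs where

open import Level using (0ℓ)
open import Data.Nat using (ℕ; suc; _^_)
open import Data.Nat.Primality using (Prime)
open import Data.Fin using (Fin; zero; suc)
open import Data.Product using (Σ; ∃; ∃-syntax; _×_; _,_)
open import Data.Sum using (_⊎_)
open import Relation.Nullary using (¬_)
open import Relation.Binary.PropositionalEquality using (_≡_; _≢_)
open import Algebra.Structures using (IsCommutativeRing)
open import Function.Bundles using (_↔_; _⇔_)

IsPrimePower : ℕ → Set
IsPrimePower q = ∃[ p ] ∃[ k ] (Prime p × q ≡ p ^ suc k)

-- A finite field with q elements (= GF(q), unique up to isomorphism).
-- Equality is propositional; the carrier is in bijection with Fin q.
record FiniteField (q : ℕ) : Set₁ where
  infixl 6 _+_
  infixl 7 _*_
  field
    K     : Set
    _+_   : K → K → K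
    _*_   : K → K → K
    -_    : K → K
    0#    : K
    1#    : K
    _⁻¹   : K → K
    isCommutativeRing : IsCommutativeRing _≡_ _+_ _*_ -_ 0# 1#
    0≢1   : 0# ≢ 1#
    inverseʳ : ∀ x → x ≢ 0# → x * (x ⁻¹) ≡ 1#
    enum  : K ↔ Fin q

module Geometry {q : ℕ} (𝔽 : FiniteField q) where
  open FiniteField 𝔽 public

  Vec4 : Set
  Vec4 = Fin 4 → K

  vec4 : K → K → K → K → Vec4
  vec4 a b c d zero = a
  vec4 a b c d (suc zero) = b
  vec4 a b c d (suc (suc zero)) = c
  vec4 a b c d (suc (suc (suc zero))) = d

  -- points of PG(3,q): non-zero vectors, compared up to non-zero scalars
  Point : Set
  Point = Σ Vec4 (λ v → ∃[ i ] v i ≢ 0#)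

  coord : Point → Vec4
  coord (v , _) = v

  _∼_ : Point → Point → Set
  P ∼ Q = ∃[ c ] (c ≢ 0# × (∀ i → coord Q i ≡ c * coord P i))

  V : Point
  V = vec4 0# 0# 0# 1# , suc (suc (suc zero)) , λ e → 0≢1 (Relation.Binary.PropositionalEquality.sym e)

  OnPlane : Vec4 → Point → Set
  OnPlane a P =
    a zero * x zero + a (suc zero) * x (suc zero)
      + a (suc (suc zero)) * x (suc (suc zero))
      + a (suc (suc (suc zero))) * x (suc (suc (suc zero))) ≡ 0#
    where x = coord P

  OnPi0 : Point → Set
  OnPi0 = OnPlane (vec4 0# 0# 0# 1#)

  Collinear : Point → Point → Point → Set
  Collinear P Q R = ∃[ a ] ∃[ b ] ∃[ c ]
    (¬ (a ≡ 0# × b ≡ 0# × c ≡ 0#)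
     × (∀ i → a * coord P i + b * coord Q i + c * coord R i ≡ 0#))

  record Collineation (φ : Point → Point) : Set where
    field
      wellDefined : ∀ P Q → P ∼ Q → φ P ∼ φ Q
      injective   : ∀ P Q → φ P ∼ φ Q → P ∼ Q
      surjective  : ∀ Q → ∃[ P ] (φ P ∼ Q)
      collinear   : ∀ P Q R → Collinear P Q R ⇔ Collinear (φ P) (φ Q) (φ R)

  planeCoeffs : (K → K) → (K → K) → (K → K) → K → Vec4
  planeCoeffs f g h t = vec4 (f t) (g t) (h t) (- 1#)

  OnPlaneOf : (K → K) → (K → K) → (K → K) → K → Point → Set
  OnPlaneOf f g h t = OnPlane (planeCoeffs f g h t)

  -- F(f,g,h) is a flock: its q planes are pairwise distinct
  -- (the equations are normalised by the coefficient -1 of x3, so the planes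
  -- π_t, π_s coincide iff (f t, g t, h t) = (f s, g s, h s))
  IsFlock : (K → K) → (K → K) → (K → K) → Set
  IsFlock f g h = ∀ t s → t ≢ s → ¬ (f t ≡ f s × g t ≡ g s × h t ≡ h s)

  IsStarFlock : (K → K) → (K → K) → (K → K) → Set
  IsStarFlock f g h = IsFlock f g h × ∃[ P ] (∀ t → OnPlaneOf f g h t P)

  InCone : (Point → Set) → Point → Set
  InCone S Q = ∃[ P ] (S P × Collinear V P Q)

  IsFlockOfCone : (K → K) → (K → K) → (K → K) → (Point → Set) → Set
  IsFlockOfCone f g h S = ∀ t s → t ≢ s → ∀ Q → InCone S Q →
    ¬ (OnPlaneOf f g h t Q × OnPlaneOf f g h s Q)

  IsCarrier : (K → K) → (K → K) → (K → K) → (Point → Set) → Set₁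
  IsCarrier f g h S0 =
    (∀ P → S0 P → OnPi0 P)
    × IsFlockOfCone f g h S0
    × (∀ (S : Point → Set) → (∀ P → S P → OnPi0 P) → IsFlockOfCone f g h S →
         ∀ P → S P → S0 P)

  Equivalent : (K → K) → (K → K) → (K → K) →
               (K → K) → (K → K) → (K → K) → Set
  Equivalent f g h f' g' h' = ∃[ φ ]
    (Collineation φ
     × φ V ∼ V
     × (∀ P → OnPi0 P ⇔ OnPi0 (φ P))
     × (∀ t → ∃[ s ] (∀ P → OnPlaneOf f g h t P ⇔ OnPlaneOf f' g' h' s (φ P)))
     × (∀ s → ∃[ t ] (∀ P → OnPlaneOf f g h t P ⇔ OnPlaneOf f' g' h' s (φ P))))

-- The common point P of the planes lies on π₀ = π_0, so (f t, g t, h t) · p = 0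
-- for every t.  A point R of the carrier lies on π₀ too; the plane π_t meets the
-- cone line V R in the point (r, u t) with u t = (f t, g t, h t) · r, so the cone
-- condition makes u injective, hence a permutation of GF(q).  Consequently r and p
-- are independent, and for a suitable w the matrix with columns r, w, p is
-- invertible.  In the coordinates it defines (keeping x₃) the plane π_t becomes
-- u t y₀ + ((f t, g t, h t) · w) y₁ - y₃ = 0, and reparametrising by s = u t
-- gives the flock F(s, g′ s, 0).

module Submission where

open import Defs
open import Data.Nat as ℕ using (ℕ; zero; suc)
import Data.Nat.Properties as ℕ
open import Data.Fin using (Fin; inject₁; _↑ˡ_; _↑ʳ_; punchOut)
open import Data.Fin.Patterns using (0F; 1F; 2F; 3F)
import Data.Fin.Properties as Fin
open import Data.Vec as Vec using (Vec)
open import Data.Vec.Functional using (Vector; _∷_; []; _++_; toVec)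
open import Data.Vec.N-ary using (N-ary; _$ⁿ_; curryⁿ-cong)
open import Data.Maybe as Maybe using (Maybe; just; nothing; From-just; from-just)
open import Data.Product using (∃-syntax; _×_; _,_; proj₁; proj₂)
open import Data.Empty using (⊥-elim)
open import Function using (_∘_; _↔_; Inverse; _⇔_; mk⇔; Equivalence)
import Function.Properties.Equivalence as ⇔
open import Function.Properties.Inverse using (↔⇒↣)
open import Relation.Nullary using (¬_; yes; no)
open import Relation.Nullary.Decidable using (via-injection)
open import Relation.Binary.Definitions using (DecidableEquality)
open import Relation.Binary.PropositionalEquality
  using (_≡_; _≢_; _≗_; cong; cong₂; subst; module ≡-Reasoning)
open import Algebra.Bundles using (CommutativeRing; RawRing)
open import Algebra.Solver.Ring.AlmostCommutativeRing
  using (fromCommutativeRing; _-Raw-AlmostCommutative⟶_)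

module CommutativeRingSolver {c ℓ} (R : CommutativeRing c ℓ) where
  open CommutativeRing R
  open import Algebra.Properties.Ring ring using (-‿distribˡ-*; -‿distribʳ-*; -‿involutive)
  open import Algebra.Properties.AbelianGroup +-abelianGroup using (⁻¹-∙-comm; ⁻¹-anti-homo‿-)
  open import Algebra.Properties.Group +-group using (x∙y⁻¹≈ε⇒x≈y; ε⁻¹≈ε)
  open import Algebra.Properties.CommutativeSemigroup +-commutativeSemigroup using (interchange)
  open import Algebra.Properties.Semiring.Mult.TCOptimised semiring
    using (×-homo-+; ×1-homo-*) renaming (_×_ to _×′_)
  open import Relation.Binary.Reasoning.Setoid setoid

  [x+y]-[z+w]≈[x-z]+[y-w] : ∀ x y z w → (x + y) - (z + w) ≈ (x - z) + (y - w)
  [x+y]-[z+w]≈[x-z]+[y-w] x y z w = begin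
    (x + y) - (z + w)      ≈⟨ +-congˡ (⁻¹-∙-comm z w) ⟨
    (x + y) + (- z + - w)  ≈⟨ interchange x y (- z) (- w) ⟩
    (x - z) + (y - w)      ∎

  [x-y]-[z-w]≈[x+w]-[y+z] : ∀ x y z w → (x - y) - (z - w) ≈ (x + w) - (y + z)
  [x-y]-[z-w]≈[x+w]-[y+z] x y z w = begin
    (x - y) - (z - w)  ≈⟨ +-congˡ (⁻¹-anti-homo‿- z w) ⟩
    (x - y) + (w - z)  ≈⟨ [x+y]-[z+w]≈[x-z]+[y-w] x w y z ⟨
    (x + w) - (y + z)  ∎

  [x-y][z-w]≈[xz+yw]-[xw+yz] : ∀ x y z w → (x - y) * (z - w) ≈ (x * z + y * w) - (x * w + y * z)
  [x-y][z-w]≈[xz+yw]-[xw+yz] x y z w = begin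
    (x - y) * (z - w)
      ≈⟨ distribʳ (z - w) x (- y) ⟩
    x * (z - w) + - y * (z - w)
      ≈⟨ +-cong (distribˡ x z (- w)) (distribˡ (- y) z (- w)) ⟩
    (x * z + x * - w) + (- y * z + - y * - w)
      ≈⟨ +-cong (+-congˡ (-‿distribʳ-* x w)) (+-cong (-‿distribˡ-* y z) (-‿distribˡ-* y (- w))) ⟨
    (x * z - x * w) + (- (y * z) + - (y * - w))
      ≈⟨ +-congˡ (+-congˡ (-‿cong (-‿distribʳ-* y w))) ⟨
    (x * z - x * w) + (- (y * z) + - - (y * w))
      ≈⟨ +-congˡ (trans (+-congˡ (-‿involutive (y * w))) (+-comm _ _)) ⟩
    (x * z - x * w) + (y * w - y * z)
      ≈⟨ [x+y]-[z+w]≈[x-z]+[y-w] _ _ _ _ ⟨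
    (x * z + y * w) - (x * w + y * z)
      ∎

  -- Coefficients are formal differences (a , b) of naturals, read as a - b.
  -- The case split in ⟦_⟧ᶜ makes the constants 0#, 1# and - 1# of an identity
  -- coincide definitionally with their polynomial counterparts.
  differences : RawRing _ _
  differences = record
    { Carrier = ℕ × ℕ
    ; _≈_     = _≡_
    ; _+_     = λ { (a , b) (c , d) → a ℕ.+ c , b ℕ.+ d }
    ; _*_     = λ { (a , b) (c , d) → a ℕ.* c ℕ.+ b ℕ.* d , a ℕ.* d ℕ.+ b ℕ.* c }
    ; -_      = λ { (a , b) → b , a }
    ; 0#      = 0 , 0
    ; 1#      = 1 , 0
    }

  ⟦_⟧ᶜ : ℕ × ℕ → Carrier
  ⟦ m , zero ⟧ᶜ      = m ×′ 1#
  ⟦ zero , suc n ⟧ᶜ  = - (suc n ×′ 1#)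
  ⟦ suc m , suc n ⟧ᶜ = suc m ×′ 1# - suc n ×′ 1#

  ⟦⟧ᶜ-difference : ∀ m n → ⟦ m , n ⟧ᶜ ≈ m ×′ 1# - n ×′ 1#
  ⟦⟧ᶜ-difference m       zero    = sym (trans (+-congˡ ε⁻¹≈ε) (+-identityʳ _))
  ⟦⟧ᶜ-difference zero    (suc n) = sym (+-identityˡ _)
  ⟦⟧ᶜ-difference (suc m) (suc n) = refl

  ⟦⟧ᶜ-+-homo : ∀ a b c d → ⟦ a ℕ.+ c , b ℕ.+ d ⟧ᶜ ≈ ⟦ a , b ⟧ᶜ + ⟦ c , d ⟧ᶜ
  ⟦⟧ᶜ-+-homo a b c d = begin
    ⟦ a ℕ.+ c , b ℕ.+ d ⟧ᶜ
      ≈⟨ ⟦⟧ᶜ-difference (a ℕ.+ c) (b ℕ.+ d) ⟩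
    (a ℕ.+ c) ×′ 1# - (b ℕ.+ d) ×′ 1#
      ≈⟨ +-cong (×-homo-+ 1# a c) (-‿cong (×-homo-+ 1# b d)) ⟩
    (a ×′ 1# + c ×′ 1#) - (b ×′ 1# + d ×′ 1#)
      ≈⟨ [x+y]-[z+w]≈[x-z]+[y-w] _ _ _ _ ⟩
    (a ×′ 1# - b ×′ 1#) + (c ×′ 1# - d ×′ 1#)
      ≈⟨ +-cong (⟦⟧ᶜ-difference a b) (⟦⟧ᶜ-difference c d) ⟨
    ⟦ a , b ⟧ᶜ + ⟦ c , d ⟧ᶜ
      ∎

  ⟦⟧ᶜ-*-homo : ∀ a b c d →
    ⟦ a ℕ.* c ℕ.+ b ℕ.* d , a ℕ.* d ℕ.+ b ℕ.* c ⟧ᶜ ≈ ⟦ a , b ⟧ᶜ * ⟦ c , d ⟧ᶜ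
  ⟦⟧ᶜ-*-homo a b c d = begin
    ⟦ a ℕ.* c ℕ.+ b ℕ.* d , a ℕ.* d ℕ.+ b ℕ.* c ⟧ᶜ
      ≈⟨ ⟦⟧ᶜ-difference (a ℕ.* c ℕ.+ b ℕ.* d) (a ℕ.* d ℕ.+ b ℕ.* c) ⟩
    (a ℕ.* c ℕ.+ b ℕ.* d) ×′ 1# - (a ℕ.* d ℕ.+ b ℕ.* c) ×′ 1#
      ≈⟨ +-cong (ι-homo a c b d) (-‿cong (ι-homo a d b c)) ⟩
    (A * C + B * D) - (A * D + B * C)
      ≈⟨ [x-y][z-w]≈[xz+yw]-[xw+yz] A B C D ⟨
    (A - B) * (C - D)
      ≈⟨ *-cong (⟦⟧ᶜ-difference a b) (⟦⟧ᶜ-difference c d) ⟨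
    ⟦ a , b ⟧ᶜ * ⟦ c , d ⟧ᶜ
      ∎
    where
    A = a ×′ 1#
    B = b ×′ 1#
    C = c ×′ 1#
    D = d ×′ 1#
    ι-homo : ∀ m n m′ n′ →
             (m ℕ.* n ℕ.+ m′ ℕ.* n′) ×′ 1# ≈ m ×′ 1# * (n ×′ 1#) + m′ ×′ 1# * (n′ ×′ 1#)
    ι-homo m n m′ n′ =
      trans (×-homo-+ 1# (m ℕ.* n) (m′ ℕ.* n′)) (+-cong (×1-homo-* m n) (×1-homo-* m′ n′))

  homomorphism : differences -Raw-AlmostCommutative⟶ fromCommutativeRing R
  homomorphism = record
    { ⟦_⟧    = ⟦_⟧ᶜ
    ; +-homo = λ { (a , b) (c , d) → ⟦⟧ᶜ-+-homo a b c d }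
    ; *-homo = λ { (a , b) (c , d) → ⟦⟧ᶜ-*-homo a b c d }
    ; -‿homo = λ { (a , b) →
        trans (⟦⟧ᶜ-difference b a) (trans (sym (⁻¹-anti-homo‿- _ _)) (-‿cong (sym (⟦⟧ᶜ-difference a b)))) }
    ; 0-homo = refl
    ; 1-homo = refl
    }

  _≟ᶜ_ : ∀ x y → Maybe (⟦ x ⟧ᶜ ≈ ⟦ y ⟧ᶜ)
  (a , b) ≟ᶜ (c , d) with a ℕ.+ d ℕ.≟ b ℕ.+ c
  ... | no _        = nothing
  ... | yes a+d≡b+c = just (begin
    ⟦ a , b ⟧ᶜ         ≈⟨ ⟦⟧ᶜ-difference a b ⟩
    a ×′ 1# - b ×′ 1#  ≈⟨ x∙y⁻¹≈ε⇒x≈y _ _ difference≈0 ⟩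
    c ×′ 1# - d ×′ 1#  ≈⟨ ⟦⟧ᶜ-difference c d ⟨
    ⟦ c , d ⟧ᶜ         ∎)
    where
    difference≈0 : (a ×′ 1# - b ×′ 1#) - (c ×′ 1# - d ×′ 1#) ≈ 0#
    difference≈0 = begin
      (a ×′ 1# - b ×′ 1#) - (c ×′ 1# - d ×′ 1#)
        ≈⟨ [x-y]-[z-w]≈[x+w]-[y+z] _ _ _ _ ⟩
      (a ×′ 1# + d ×′ 1#) - (b ×′ 1# + c ×′ 1#)
        ≈⟨ +-cong (×-homo-+ 1# a d) (-‿cong (×-homo-+ 1# b c)) ⟨
      (a ℕ.+ d) ×′ 1# - (b ℕ.+ c) ×′ 1#
        ≈⟨ +-congˡ (-‿cong (reflexive (cong (_×′ 1#) a+d≡b+c))) ⟨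
      (a ℕ.+ d) ×′ 1# - (a ℕ.+ d) ×′ 1#
        ≈⟨ -‿inverseʳ _ ⟩
      0#
        ∎

  open import Algebra.Solver.Ring differences (fromCommutativeRing R) homomorphism _≟ᶜ_ public
    using (Polynomial; con; var; _:+_; _:*_; :-_; _:=_)
  open import Algebra.Solver.Ring differences (fromCommutativeRing R) homomorphism _≟ᶜ_
    using (⟦_⟧; normalise; _≟N_; ⟦_⟧N-cong; correct)

  -- Normal forms are compared with _≟N_ rather than syntactically, since a
  -- coefficient such as (1 , 1) is not literally (0 , 0).
  equal? : ∀ {n} (p₁ p₂ : Polynomial n) → Maybe (∀ ρ → ⟦ p₁ ⟧ ρ ≈ ⟦ p₂ ⟧ ρ)
  equal? p₁ p₂ = Maybe.map (λ nf₁≈nf₂ ρ → trans (sym (correct p₁ ρ)) (trans (⟦ nf₁≈nf₂ ⟧N-cong ρ) (correct p₂ ρ)))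
                           (normalise p₁ ≟N normalise p₂)

  prove : ∀ {n} (p₁ p₂ : Polynomial n) → From-just (equal? p₁ p₂)
  prove p₁ p₂ = from-just (equal? p₁ p₂)

  close : ∀ n → N-ary n (Polynomial n) (Polynomial n × Polynomial n) → Polynomial n × Polynomial n
  close n f = f $ⁿ Vec.map var (Vec.allFin n)

  solve : ∀ n (f : N-ary n (Polynomial n) (Polynomial n × Polynomial n)) →
          From-just (Maybe.map (curryⁿ-cong _≈_ ⟦ proj₁ (close n f) ⟧ ⟦ proj₂ (close n f) ⟧)
                               (equal? (proj₁ (close n f)) (proj₂ (close n f))))
  solve n f = from-just (Maybe.map (curryⁿ-cong _≈_ ⟦ proj₁ (close n f) ⟧ ⟦ proj₂ (close n f) ⟧)
                                   (equal? (proj₁ (close n f)) (proj₂ (close n f))))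

open import Relation.Binary.PropositionalEquality using (refl; sym; trans)

injective⇒surjective : ∀ {n} (f : Fin n → Fin n) → (∀ {x y} → f x ≡ f y → x ≡ y) →
                       ∀ y → ∃[ x ] f x ≡ y
injective⇒surjective {suc m} f f-injective y with Fin.any? (λ x → f x Fin.≟ y)
... | yes hit = hit
... | no miss = ⊥-elim (ℕ.<-irrefl refl (Fin.injective⇒≤ missing-y-injective))
  where
  y≢f : ∀ x → y ≢ f x
  y≢f x y≡fx = miss (x , sym y≡fx)

  missing-y : Fin (suc m) → Fin m
  missing-y x = punchOut (y≢f x)

  missing-y-injective : ∀ {x x′} → missing-y x ≡ missing-y x′ → x ≡ x′
  missing-y-injective e = f-injective (Fin.punchOut-injective (y≢f _) (y≢f _) e)

module _ {a} {A : Set a} {n} (enum : A ↔ Fin n) where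
  private
    module E = Inverse enum

    to-injective : ∀ {x y} → E.to x ≡ E.to y → x ≡ y
    to-injective {x} {y} e = begin
      x                ≡⟨ E.strictlyInverseʳ x ⟨
      E.from (E.to x)  ≡⟨ cong E.from e ⟩
      E.from (E.to y)  ≡⟨ E.strictlyInverseʳ y ⟩
      y                ∎
      where open ≡-Reasoning

  finite-injective⇒surjective : (f : A → A) → (∀ {x y} → f x ≡ f y → x ≡ y) →
                                ∀ y → ∃[ x ] f x ≡ y
  finite-injective⇒surjective f f-injective y =
    let i , e = injective⇒surjective (E.to ∘ f ∘ E.from) conjugate-injective (E.to y)
    in E.from i , to-injective e
    where
    conjugate-injective : ∀ {i j} → E.to (f (E.from i)) ≡ E.to (f (E.from j)) → i ≡ j
    conjugate-injective {i} {j} e = begin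
      i                ≡⟨ E.strictlyInverseˡ i ⟨
      E.to (E.from i)  ≡⟨ cong E.to (f-injective (to-injective e)) ⟩
      E.to (E.from j)  ≡⟨ E.strictlyInverseˡ j ⟩
      j                ∎
      where open ≡-Reasoning

module Vector3 {c ℓ} (R : RawRing c ℓ) where
  open RawRing R

  Vec3 : Set c
  Vec3 = Vector Carrier 3

  Mat3 : Set c
  Mat3 = Vector Vec3 3

  dot₃ : Vec3 → Vec3 → Carrier
  dot₃ u v = u 0F * v 0F + u 1F * v 1F + u 2F * v 2F

  cross : Vec3 → Vec3 → Vec3
  cross u v = (u 1F * v 2F + - (u 2F * v 1F))
            ∷ (u 2F * v 0F + - (u 0F * v 2F))
            ∷ (u 0F * v 1F + - (u 1F * v 0F))
            ∷ []

  det : Vec3 → Vec3 → Vec3 → Carrier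
  det u v w = dot₃ u (cross v w)

  basis : Fin 3 → Vec3
  basis 0F = 1# ∷ 0# ∷ 0# ∷ []
  basis 1F = 0# ∷ 1# ∷ 0# ∷ []
  basis 2F = 0# ∷ 0# ∷ 1# ∷ []

  infixr 7 _·ᵥ_
  infixr 8 _·ₘ_

  _·ᵥ_ : Mat3 → Vec3 → Vec3
  (M ·ᵥ x) i = dot₃ (M i) x

  _·ₘ_ : Carrier → Mat3 → Mat3
  (z ·ₘ M) i j = z * M i j

  columns : Vec3 → Vec3 → Vec3 → Mat3
  columns u v w i = u i ∷ v i ∷ w i ∷ []

  adjugate : Vec3 → Vec3 → Vec3 → Mat3
  adjugate u v w = cross v w ∷ cross w u ∷ cross u v ∷ []

module FiniteFieldAlgebra {q} (𝔽 : FiniteField q) where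
  open FiniteField 𝔽

  commutativeRing : CommutativeRing _ _
  commutativeRing = record { isCommutativeRing = isCommutativeRing }

  open CommutativeRing commutativeRing public
    using (+-identityˡ; *-identityˡ; *-assoc; *-comm; zeroˡ; zeroʳ; rawRing)
  open import Algebra.Properties.Ring (CommutativeRing.ring commutativeRing) using (-1*x≈-x)
  open import Algebra.Properties.Group (CommutativeRing.+-group commutativeRing)
    using (x∙y⁻¹≈ε⇒x≈y; x≈y⇒x∙y⁻¹≈ε)
  open CommutativeRingSolver commutativeRing public using (solve; con; _:+_; _:*_; :-_; _:=_)
  open CommutativeRingSolver commutativeRing using (Polynomial; var; prove)
  open Vector3 rawRing public

  _≟_ : DecidableEquality K
  _≟_ = via-injection (↔⇒↣ enum) Fin._≟_

  nonzeroCoordinate : ∀ {n} (x : Vector K n) → ¬ (∀ i → x i ≡ 0#) → ∃[ i ] x i ≢ 0#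
  nonzeroCoordinate {n} x = Fin.¬∀⟶∃¬ n _ (λ i → x i ≟ 0#)

  x-y≡0⇔x≡y : ∀ x y → x + (- 1#) * y ≡ 0# ⇔ x ≡ y
  x-y≡0⇔x≡y x y = mk⇔ (λ e → x∙y⁻¹≈ε⇒x≈y x y (trans (cong (x +_) (sym (-1*x≈-x y))) e))
                       (λ e → trans (cong (x +_) (-1*x≈-x y)) (x≈y⇒x∙y⁻¹≈ε e))

  x*y≡0⇒y≡0 : ∀ {x y} → x * y ≡ 0# → x ≢ 0# → y ≡ 0#
  x*y≡0⇒y≡0 {x} {y} xy≡0 x≢0 = begin
    y                ≡⟨ *-identityˡ y ⟨
    1# * y           ≡⟨ cong (_* y) (trans (*-comm _ _) (inverseʳ x x≢0)) ⟨
    x ⁻¹ * x * y     ≡⟨ *-assoc (x ⁻¹) x y ⟩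
    x ⁻¹ * (x * y)   ≡⟨ cong (x ⁻¹ *_) xy≡0 ⟩
    x ⁻¹ * 0#        ≡⟨ zeroʳ (x ⁻¹) ⟩
    0#               ∎
    where open ≡-Reasoning

  dot₃-congˡ : ∀ {u u′} → u ≗ u′ → ∀ v → dot₃ u v ≡ dot₃ u′ v
  dot₃-congˡ e v =
    cong₂ _+_ (cong₂ _+_ (cong (_* v 0F) (e 0F)) (cong (_* v 1F) (e 1F))) (cong (_* v 2F) (e 2F))

  dot₃-congʳ : ∀ u {v v′} → v ≗ v′ → dot₃ u v ≡ dot₃ u v′
  dot₃-congʳ u e =
    cong₂ _+_ (cong₂ _+_ (cong (u 0F *_) (e 0F)) (cong (u 1F *_) (e 1F))) (cong (u 2F *_) (e 2F))

  -- Vector3 over polynomial syntax states vector identities for the ring solver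
  -- in the same notation; 𝐮 … 𝐲 are the coordinates of five vectors, which
  -- `entries` instantiates.
  private
    polynomials : RawRing _ _
    polynomials = record
      { Carrier = Polynomial 15 ; _≈_ = _≡_ ; _+_ = _:+_ ; _*_ = _:*_ ; -_ = :-_
      ; 0# = con (0 , 0) ; 1# = con (1 , 0) }

    module P = Vector3 polynomials

    𝐮 𝐯 𝐰 𝐱 𝐲 : P.Vec3
    𝐮 i = var (i ↑ˡ 12)
    𝐯 i = var (3 ↑ʳ (i ↑ˡ 9))
    𝐰 i = var (6 ↑ʳ (i ↑ˡ 6))
    𝐱 i = var (9 ↑ʳ (i ↑ˡ 3))
    𝐲 i = var (12 ↑ʳ i)

    𝐳 𝐃 : Polynomial 15
    𝐳 = 𝐲 0F
    𝐃 = P.det 𝐮 𝐯 𝐰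

    𝐍 𝐀 : P.Mat3
    𝐍 = P.columns 𝐮 𝐯 𝐰
    𝐀 = P.adjugate 𝐮 𝐯 𝐰

    entries : Vec3 → Vec3 → Vec3 → Vec3 → Vec3 → Vec K 15
    entries u v w x y = toVec (u ++ v ++ w ++ x ++ y)

  dot₃-zeroˡ : ∀ v → dot₃ (λ _ → 0#) v ≡ 0#
  dot₃-zeroˡ v = prove (P.dot₃ (λ _ → con (0 , 0)) 𝐯) (con (0 , 0)) (entries v v v v v)

  dot₃-zeroʳ : ∀ u → dot₃ u (λ _ → 0#) ≡ 0#
  dot₃-zeroʳ u = prove (P.dot₃ 𝐮 (λ _ → con (0 , 0))) (con (0 , 0)) (entries u u u u u)

  dot₃-scaleʳ : ∀ u c v → dot₃ u (λ j → c * v j) ≡ c * dot₃ u v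
  dot₃-scaleʳ u c v =
    prove (P.dot₃ 𝐮 (λ j → 𝐯 0F :* 𝐰 j)) (𝐯 0F :* P.dot₃ 𝐮 𝐰) (entries u (λ _ → c) v v v)

  dot₃-combinationʳ : ∀ u a b c x y z →
    dot₃ u (λ j → a * x j + b * y j + c * z j) ≡ a * dot₃ u x + b * dot₃ u y + c * dot₃ u z
  dot₃-combinationʳ u a b c x y z =
    prove (P.dot₃ 𝐮 (λ j → 𝐯 0F :* 𝐰 j :+ 𝐯 1F :* 𝐱 j :+ 𝐯 2F :* 𝐲 j))
          (𝐯 0F :* P.dot₃ 𝐮 𝐰 :+ 𝐯 1F :* P.dot₃ 𝐮 𝐱 :+ 𝐯 2F :* P.dot₃ 𝐮 𝐲)
          (entries u (a ∷ b ∷ c ∷ []) x y z)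

  dot₃-columns : ∀ a u v w y →
    dot₃ a (columns u v w ·ᵥ y) ≡ dot₃ (dot₃ a u ∷ dot₃ a v ∷ dot₃ a w ∷ []) y
  dot₃-columns a u v w y =
    prove (P.dot₃ 𝐮 (P.columns 𝐯 𝐰 𝐱 P.·ᵥ 𝐲))
          (P.dot₃ (P.dot₃ 𝐮 𝐯 ∷ P.dot₃ 𝐮 𝐰 ∷ P.dot₃ 𝐮 𝐱 ∷ []) 𝐲)
          (entries a u v w y)

  dot₃-basisˡ : ∀ i u → dot₃ (basis i) u ≡ u i
  dot₃-basisˡ 0F u = prove (P.dot₃ (P.basis 0F) 𝐮) (𝐮 0F) (entries u u u u u)
  dot₃-basisˡ 1F u = prove (P.dot₃ (P.basis 1F) 𝐮) (𝐮 1F) (entries u u u u u)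
  dot₃-basisˡ 2F u = prove (P.dot₃ (P.basis 2F) 𝐮) (𝐮 2F) (entries u u u u u)

  det-rotate : ∀ u v w → det u v w ≡ dot₃ v (cross w u)
  det-rotate u v w = prove (P.det 𝐮 𝐯 𝐰) (P.dot₃ 𝐯 (P.cross 𝐰 𝐮)) (entries u v w w w)

  binet-cauchy : ∀ a b c d → dot₃ (cross a b) (cross c d) + dot₃ d a * dot₃ c b ≡ dot₃ c a * dot₃ d b
  binet-cauchy a b c d =
    prove (P.dot₃ (P.cross 𝐮 𝐯) (P.cross 𝐰 𝐱) :+ P.dot₃ 𝐱 𝐮 :* P.dot₃ 𝐰 𝐯)
          (P.dot₃ 𝐰 𝐮 :* P.dot₃ 𝐱 𝐯)
          (entries a b c d d)

  columns-adjugate : ∀ z u v w x i → (columns u v w ·ᵥ z ·ₘ adjugate u v w ·ᵥ x) i ≡ z * det u v w * x i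
  columns-adjugate z u v w x 0F =
    prove ((𝐍 P.·ᵥ 𝐳 P.·ₘ 𝐀 P.·ᵥ 𝐱) 0F) (𝐳 :* 𝐃 :* 𝐱 0F) (entries u v w x (λ _ → z))
  columns-adjugate z u v w x 1F =
    prove ((𝐍 P.·ᵥ 𝐳 P.·ₘ 𝐀 P.·ᵥ 𝐱) 1F) (𝐳 :* 𝐃 :* 𝐱 1F) (entries u v w x (λ _ → z))
  columns-adjugate z u v w x 2F =
    prove ((𝐍 P.·ᵥ 𝐳 P.·ₘ 𝐀 P.·ᵥ 𝐱) 2F) (𝐳 :* 𝐃 :* 𝐱 2F) (entries u v w x (λ _ → z))

  adjugate-columns : ∀ z u v w x i → (z ·ₘ adjugate u v w ·ᵥ columns u v w ·ᵥ x) i ≡ z * det u v w * x i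
  adjugate-columns z u v w x 0F =
    prove ((𝐳 P.·ₘ 𝐀 P.·ᵥ 𝐍 P.·ᵥ 𝐱) 0F) (𝐳 :* 𝐃 :* 𝐱 0F) (entries u v w x (λ _ → z))
  adjugate-columns z u v w x 1F =
    prove ((𝐳 P.·ₘ 𝐀 P.·ᵥ 𝐍 P.·ᵥ 𝐱) 1F) (𝐳 :* 𝐃 :* 𝐱 1F) (entries u v w x (λ _ → z))
  adjugate-columns z u v w x 2F =
    prove ((𝐳 P.·ₘ 𝐀 P.·ᵥ 𝐍 P.·ᵥ 𝐱) 2F) (𝐳 :* 𝐃 :* 𝐱 2F) (entries u v w x (λ _ → z))

  columns-invertible : ∀ z u v w → z * det u v w ≡ 1# →
    (∀ x → columns u v w ·ᵥ z ·ₘ adjugate u v w ·ᵥ x ≗ x) ×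
    (∀ x → z ·ₘ adjugate u v w ·ᵥ columns u v w ·ᵥ x ≗ x)
  columns-invertible z u v w zD≡1 =
    (λ x i → trans (columns-adjugate z u v w x i) (cancel x i)) ,
    (λ x i → trans (adjugate-columns z u v w x i) (cancel x i))
    where
    cancel : ∀ x i → z * det u v w * x i ≡ x i
    cancel x i = trans (cong (_* x i) zD≡1) (*-identityˡ (x i))

module PG3 {q} (𝔽 : FiniteField q) where
  open Geometry 𝔽
  open FiniteFieldAlgebra 𝔽

  affine : Vec4 → Vec3
  affine x = x ∘ inject₁

  normal : (K → K) → (K → K) → (K → K) → K → Vec3
  normal f g h t = f t ∷ g t ∷ h t ∷ []

  onPlaneOf⇔ : ∀ f g h t X →
    OnPlaneOf f g h t X ⇔ dot₃ (normal f g h t) (affine (coord X)) ≡ coord X 3F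
  onPlaneOf⇔ f g h t X = x-y≡0⇔x≡y _ _

  onPi0⇔ : ∀ X → OnPi0 X ⇔ coord X 3F ≡ 0#
  onPi0⇔ X = mk⇔ (trans (sym lhs≡x₃)) (trans lhs≡x₃)
    where
    lhs≡x₃ : dot₃ (λ _ → 0#) (affine (coord X)) + 1# * coord X 3F ≡ coord X 3F
    lhs≡x₃ = trans (cong₂ _+_ (dot₃-zeroˡ (affine (coord X))) (*-identityˡ _)) (+-identityˡ _)

  affine-nonzero : ∀ X → coord X 3F ≡ 0# → ∃[ k ] affine (coord X) k ≢ 0#
  affine-nonzero (x , 0F , x₀≢0) _ = 0F , x₀≢0
  affine-nonzero (x , 1F , x₁≢0) _ = 1F , x₁≢0
  affine-nonzero (x , 2F , x₂≢0) _ = 2F , x₂≢0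
  affine-nonzero (x , 3F , x₃≢0) x₃≡0 = ⊥-elim (x₃≢0 x₃≡0)

  onLineV : (v : Vec3) → ∃[ k ] v k ≢ 0# → K → Point
  onLineV v v≢0 c = vec4 (v 0F) (v 1F) (v 2F) c , nonzero v≢0
    where
    nonzero : ∃[ k ] v k ≢ 0# → ∃[ i ] vec4 (v 0F) (v 1F) (v 2F) c i ≢ 0#
    nonzero (0F , v₀≢0) = 0F , v₀≢0
    nonzero (1F , v₁≢0) = 1F , v₁≢0
    nonzero (2F , v₂≢0) = 2F , v₂≢0

  onLineV-collinear : ∀ X (X∈π₀ : coord X 3F ≡ 0#) c →
    Collinear V X (onLineV (affine (coord X)) (affine-nonzero X X∈π₀) c)
  onLineV-collinear X X∈π₀ c = c , 1# , - 1# , (λ (_ , 1≡0 , _) → 0≢1 (sym 1≡0)) , λ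
    { 0F → off-V c (coord X 0F)
    ; 1F → off-V c (coord X 1F)
    ; 2F → off-V c (coord X 2F)
    ; 3F → trans (cong (λ x₃ → c * 1# + 1# * x₃ + (- 1#) * c) X∈π₀) (on-V c) }
    where
    off-V : ∀ c x → c * 0# + 1# * x + (- 1#) * x ≡ 0#
    off-V = solve 2 (λ c x →
      c :* con (0 , 0) :+ con (1 , 0) :* x :+ :- con (1 , 0) :* x := con (0 , 0))
    on-V : ∀ c → c * 1# + 1# * 0# + (- 1#) * c ≡ 0#
    on-V = solve 1 (λ c →
      c :* con (1 , 0) :+ con (1 , 0) :* con (0 , 0) :+ :- con (1 , 0) :* c := con (0 , 0))

  extend : Mat3 → Vec4 → Vec4
  extend M x = vec4 ((M ·ᵥ affine x) 0F) ((M ·ᵥ affine x) 1F) ((M ·ᵥ affine x) 2F) (x 3F)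

  extend-cong : ∀ M {x y} → x ≗ y → extend M x ≗ extend M y
  extend-cong M x≗y 0F = dot₃-congʳ (M 0F) (x≗y ∘ inject₁)
  extend-cong M x≗y 1F = dot₃-congʳ (M 1F) (x≗y ∘ inject₁)
  extend-cong M x≗y 2F = dot₃-congʳ (M 2F) (x≗y ∘ inject₁)
  extend-cong M x≗y 3F = x≗y 3F

  extend-scale : ∀ M c x → extend M (λ i → c * x i) ≗ (λ i → c * extend M x i)
  extend-scale M c x 0F = dot₃-scaleʳ (M 0F) c (affine x)
  extend-scale M c x 1F = dot₃-scaleʳ (M 1F) c (affine x)
  extend-scale M c x 2F = dot₃-scaleʳ (M 2F) c (affine x)
  extend-scale M c x 3F = refl

  extend-zero : ∀ M → extend M (λ _ → 0#) ≗ (λ _ → 0#)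
  extend-zero M 0F = dot₃-zeroʳ (M 0F)
  extend-zero M 1F = dot₃-zeroʳ (M 1F)
  extend-zero M 2F = dot₃-zeroʳ (M 2F)
  extend-zero M 3F = refl

  extend-fixes-V : ∀ M → extend M (coord V) ≗ coord V
  extend-fixes-V M 0F = dot₃-zeroʳ (M 0F)
  extend-fixes-V M 1F = dot₃-zeroʳ (M 1F)
  extend-fixes-V M 2F = dot₃-zeroʳ (M 2F)
  extend-fixes-V M 3F = refl

  extend-inverse : ∀ M N → (∀ x → N ·ᵥ M ·ᵥ x ≗ x) → ∀ x → extend N (extend M x) ≗ x
  extend-inverse M N NM x 0F = NM (affine x) 0F
  extend-inverse M N NM x 1F = NM (affine x) 1F
  extend-inverse M N NM x 2F = NM (affine x) 2F
  extend-inverse M N NM x 3F = refl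

  extend-dependent : ∀ M a b c {x y z} → (∀ i → a * x i + b * y i + c * z i ≡ 0#) →
    ∀ i → a * extend M x i + b * extend M y i + c * extend M z i ≡ 0#
  extend-dependent M a b c {x} {y} {z} dependent = λ
    { 0F → row-dependent 0F ; 1F → row-dependent 1F ; 2F → row-dependent 2F ; 3F → dependent 3F }
    where
    row-dependent : ∀ k →
      a * (M ·ᵥ affine x) k + b * (M ·ᵥ affine y) k + c * (M ·ᵥ affine z) k ≡ 0#
    row-dependent k = begin
      a * (M ·ᵥ affine x) k + b * (M ·ᵥ affine y) k + c * (M ·ᵥ affine z) k
        ≡⟨ dot₃-combinationʳ (M k) a b c (affine x) (affine y) (affine z) ⟨
      dot₃ (M k) (λ j → a * affine x j + b * affine y j + c * affine z j)
        ≡⟨ dot₃-congʳ (M k) (dependent ∘ inject₁) ⟩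
      dot₃ (M k) (λ _ → 0#)
        ≡⟨ dot₃-zeroʳ (M k) ⟩
      0# ∎
      where open ≡-Reasoning

  image : (M N : Mat3) → (∀ x → N ·ᵥ M ·ᵥ x ≗ x) → Point → Point
  image M N NM (x , i , xᵢ≢0) = extend M x , nonzeroCoordinate (extend M x) (xᵢ≢0 ∘ xᵢ≡0)
    where
    xᵢ≡0 : (∀ j → extend M x j ≡ 0#) → x i ≡ 0#
    xᵢ≡0 Mx≡0 = trans (sym (extend-inverse M N NM x i))
                      (trans (extend-cong N Mx≡0 i) (extend-zero N i))

  ≗⇒∼ : ∀ X Y → coord X ≗ coord Y → X ∼ Y
  ≗⇒∼ _ _ X≗Y = 1# , (λ 1≡0 → 0≢1 (sym 1≡0)) , λ i → sym (trans (*-identityˡ _) (X≗Y i))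

  image-fixes-V : ∀ M N NM → image M N NM V ∼ V
  image-fixes-V M N NM = ≗⇒∼ (image M N NM V) V (extend-fixes-V M)

  image-stabilises-π₀ : ∀ M N NM X → OnPi0 X ⇔ OnPi0 (image M N NM X)
  image-stabilises-π₀ M N NM X = ⇔.trans (onPi0⇔ X) (⇔.sym (onPi0⇔ (image M N NM X)))

  module _ (M N : Mat3) (NM : ∀ x → N ·ᵥ M ·ᵥ x ≗ x) (MN : ∀ x → M ·ᵥ N ·ᵥ x ≗ x) where

    image-collineation : Collineation (image M N NM)
    image-collineation = record
      { wellDefined = λ { X Y (c , c≢0 , Y≡cX) →
          c , c≢0 , λ i → trans (extend-cong M Y≡cX i) (extend-scale M c (coord X) i) }
      ; injective = λ { X Y (c , c≢0 , φY≡cφX) → c , c≢0 , λ i → begin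
          coord Y i                                    ≡⟨ extend-inverse M N NM (coord Y) i ⟨
          extend N (extend M (coord Y)) i              ≡⟨ extend-cong N φY≡cφX i ⟩
          extend N (λ j → c * extend M (coord X) j) i  ≡⟨ extend-scale N c (extend M (coord X)) i ⟩
          c * extend N (extend M (coord X)) i          ≡⟨ cong (c *_) (extend-inverse M N NM (coord X) i) ⟩
          c * coord X i                                ∎ }
      ; surjective = λ Y →
          image N M MN Y , ≗⇒∼ (image M N NM (image N M MN Y)) Y (extend-inverse N M MN (coord Y))
      ; collinear = λ X Y Z → mk⇔
          (λ { (a , b , c , nontrivial , dependent) →
                 a , b , c , nontrivial , extend-dependent M a b c dependent })
          (λ { (a , b , c , nontrivial , dependent) →
                 a , b , c , nontrivial , λ i →
                   trans (cong₂ _+_ (cong₂ _+_ (cong (a *_) (sym (extend-inverse M N NM (coord X) i)))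
                                               (cong (b *_) (sym (extend-inverse M N NM (coord Y) i))))
                                    (cong (c *_) (sym (extend-inverse M N NM (coord Z) i))))
                         (extend-dependent N a b c dependent i) })
      }
      where open ≡-Reasoning

module StarFlock {q} (𝔽 : FiniteField q) where
  open Geometry 𝔽
  open FiniteFieldAlgebra 𝔽
  open PG3 𝔽

  module _ (f g h : K → K) (f0 : f 0# ≡ 0#) (g0 : g 0# ≡ 0#) (h0 : h 0# ≡ 0#)
           (P : Point) (P∈π : ∀ t → OnPlaneOf f g h t P)
           (S : Point → Set) (cone : IsFlockOfCone f g h S)
           (R : Point) (R∈S : S R) (R∈π0 : OnPi0 R) where

    n : K → Vec3
    n = normal f g h

    p r : Vec3
    p = affine (coord P)
    r = affine (coord R)

    n₀-zero : ∀ v → dot₃ (n 0#) v ≡ 0#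
    n₀-zero v = trans (dot₃-congˡ {n 0#} {λ _ → 0#} (λ { 0F → f0 ; 1F → g0 ; 2F → h0 }) v)
                      (dot₃-zeroˡ v)

    P₃≡0 : coord P 3F ≡ 0#
    P₃≡0 = trans (sym (Equivalence.to (onPlaneOf⇔ f g h 0# P) (P∈π 0#))) (n₀-zero p)

    n·p≡0 : ∀ t → dot₃ (n t) p ≡ 0#
    n·p≡0 t = trans (Equivalence.to (onPlaneOf⇔ f g h t P) (P∈π t)) P₃≡0

    R₃≡0 : coord R 3F ≡ 0#
    R₃≡0 = Equivalence.to (onPi0⇔ R) R∈π0

    u : K → K
    u t = dot₃ (n t) r

    lineVR : K → Point
    lineVR = onLineV r (affine-nonzero R R₃≡0)

    u-injective : ∀ {t s} → u t ≡ u s → t ≡ s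
    u-injective {t} {s} uₜ≡uₛ with t ≟ s
    ... | yes t≡s = t≡s
    ... | no t≢s = ⊥-elim (cone t s t≢s (lineVR (u t)) (R , R∈S , onLineV-collinear R R₃≡0 (u t))
                                (meets t refl , meets s (sym uₜ≡uₛ)))
      where
      meets : ∀ t′ → u t′ ≡ u t → OnPlaneOf f g h t′ (lineVR (u t))
      meets t′ = Equivalence.from (onPlaneOf⇔ f g h t′ (lineVR (u t)))

    u-surjective : ∀ s → ∃[ t ] u t ≡ s
    u-surjective = finite-injective⇒surjective enum u u-injective

    u⁻¹ : K → K
    u⁻¹ s = proj₁ (u-surjective s)

    u∘u⁻¹ : ∀ s → u (u⁻¹ s) ≡ s
    u∘u⁻¹ s = proj₂ (u-surjective s)

    u⁻¹∘u : ∀ t → u⁻¹ (u t) ≡ t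
    u⁻¹∘u t = u-injective (u∘u⁻¹ (u t))

    -- If p × r vanished, Binet–Cauchy would make every p k * u t zero, so u
    -- could not be injective.
    p×r≢0 : ¬ (∀ k → cross p r k ≡ 0#)
    p×r≢0 p×r≡0 = 0≢1 (u-injective (trans (u≡0 0#) (sym (u≡0 1#))))
      where
      k = proj₁ (affine-nonzero P P₃≡0)

      u≡0 : ∀ t → u t ≡ 0#
      u≡0 t = x*y≡0⇒y≡0 (begin
        p k * u t
          ≡⟨ cong (_* u t) (dot₃-basisˡ k p) ⟨
        dot₃ (basis k) p * u t
          ≡⟨ +-identityˡ (dot₃ (basis k) p * u t) ⟨
        0# + dot₃ (basis k) p * u t
          ≡⟨ cong (_+ dot₃ (basis k) p * u t) cross-term≡0 ⟨
        dot₃ (cross p r) (cross (n t) (basis k)) + dot₃ (basis k) p * u t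
          ≡⟨ binet-cauchy p r (n t) (basis k) ⟩
        dot₃ (n t) p * dot₃ (basis k) r
          ≡⟨ cong (_* dot₃ (basis k) r) (n·p≡0 t) ⟩
        0# * dot₃ (basis k) r
          ≡⟨ zeroˡ (dot₃ (basis k) r) ⟩
        0#
          ∎)
        (proj₂ (affine-nonzero P P₃≡0))
        where
        open ≡-Reasoning
        cross-term≡0 : dot₃ (cross p r) (cross (n t) (basis k)) ≡ 0#
        cross-term≡0 = trans (dot₃-congˡ {cross p r} {λ _ → 0#} p×r≡0 (cross (n t) (basis k)))
                             (dot₃-zeroˡ (cross (n t) (basis k)))

    k : Fin 3
    k = proj₁ (nonzeroCoordinate (cross p r) p×r≢0)

    w : Vec3
    w = basis k

    D : K
    D = det r w p

    D≢0 : D ≢ 0#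
    D≢0 D≡0 = proj₂ (nonzeroCoordinate (cross p r) p×r≢0)
                    (trans (sym (trans (det-rotate r w p) (dot₃-basisˡ k (cross p r)))) D≡0)

    M N : Mat3
    M = D ⁻¹ ·ₘ adjugate r w p
    N = columns r w p

    D⁻¹D≡1 : D ⁻¹ * D ≡ 1#
    D⁻¹D≡1 = trans (*-comm (D ⁻¹) D) (inverseʳ D D≢0)

    N∘M : ∀ x → N ·ᵥ M ·ᵥ x ≗ x
    N∘M = proj₁ (columns-invertible (D ⁻¹) r w p D⁻¹D≡1)

    M∘N : ∀ x → M ·ᵥ N ·ᵥ x ≗ x
    M∘N = proj₂ (columns-invertible (D ⁻¹) r w p D⁻¹D≡1)

    φ : Point → Point
    φ = image M N N∘M

    g′ : K → K
    g′ s = dot₃ (n (u⁻¹ s)) w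

    g′0≡0 : g′ 0# ≡ 0#
    g′0≡0 = trans (cong (λ t → dot₃ (n t) w) u⁻¹0≡0) (n₀-zero w)
      where
      u⁻¹0≡0 : u⁻¹ 0# ≡ 0#
      u⁻¹0≡0 = u-injective (trans (u∘u⁻¹ 0#) (sym (n₀-zero r)))

    transfer : ∀ t x →
      dot₃ (n t) (affine x) ≡ dot₃ (normal (λ s → s) g′ (λ _ → 0#) (u t)) (M ·ᵥ affine x)
    transfer t x = begin
      dot₃ (n t) (affine x)
        ≡⟨ dot₃-congʳ (n t) (N∘M (affine x)) ⟨
      dot₃ (n t) (N ·ᵥ M ·ᵥ affine x)
        ≡⟨ dot₃-columns (n t) r w p (M ·ᵥ affine x) ⟩
      dot₃ (u t ∷ dot₃ (n t) w ∷ dot₃ (n t) p ∷ []) (M ·ᵥ affine x)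
        ≡⟨ dot₃-congˡ coefficients (M ·ᵥ affine x) ⟩
      dot₃ (u t ∷ g′ (u t) ∷ 0# ∷ []) (M ·ᵥ affine x)
        ∎
      where
      open ≡-Reasoning
      coefficients : (u t ∷ dot₃ (n t) w ∷ dot₃ (n t) p ∷ []) ≗ (u t ∷ g′ (u t) ∷ 0# ∷ [])
      coefficients 0F = refl
      coefficients 1F = cong (λ t′ → dot₃ (n t′) w) (sym (u⁻¹∘u t))
      coefficients 2F = n·p≡0 t

    planes : ∀ t X → OnPlaneOf f g h t X ⇔ OnPlaneOf (λ s → s) g′ (λ _ → 0#) (u t) (φ X)
    planes t X = ⇔.trans (onPlaneOf⇔ f g h t X)
                 (⇔.trans (mk⇔ (trans (sym (transfer t (coord X)))) (trans (transfer t (coord X))))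
                          (⇔.sym (onPlaneOf⇔ (λ s → s) g′ (λ _ → 0#) (u t) (φ X))))

    normalForm : ∃[ g′ ] (g′ 0# ≡ 0# × IsFlock (λ t → t) g′ (λ _ → 0#)
                          × Equivalent f g h (λ t → t) g′ (λ _ → 0#))
    normalForm = g′ , g′0≡0 , (λ t s t≢s same → t≢s (proj₁ same)) ,
      φ , image-collineation M N N∘M M∘N , image-fixes-V M N N∘M , image-stabilises-π₀ M N N∘M ,
      (λ t → u t , planes t) ,
      (λ s → u⁻¹ s , λ X →
        subst (λ s′ → OnPlaneOf f g h (u⁻¹ s) X ⇔ OnPlaneOf (λ t → t) g′ (λ _ → 0#) s′ (φ X))
              (u∘u⁻¹ s) (planes (u⁻¹ s) X))

theorem3p3 : (q : ℕ) → IsPrimePower q → (𝔽 : FiniteField q) →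
    let open Geometry 𝔽 in
    (f g h : K → K) → f 0# ≡ 0# → g 0# ≡ 0# → h 0# ≡ 0# →
    IsStarFlock f g h →
    (∃[ S0 ] (IsCarrier f g h S0 × ∃[ P ] S0 P)) →
    ∃[ g' ] (g' 0# ≡ 0# × IsFlock (λ t → t) g' (λ _ → 0#)
             × Equivalent f g h (λ t → t) g' (λ _ → 0#))
theorem3p3 q _ 𝔽 f g h f0 g0 h0 (_ , P , P∈π) (S0 , (S0⊆π₀ , cone , _) , R , R∈S0) =
  StarFlock.normalForm 𝔽 f g h f0 g0 h0 P P∈π S0 cone R R∈S0 (S0⊆π₀ R R∈S0)
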